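{- Let $t$ be a binary tree with $n$ nodes, partitioned by the Farzan–Munro algorithm with parameter $B$ into micro trees $\mu_1,\dots,\mu_m$ with split ranks $s_1,\dots,s_m$. Let $H$ be a Huffman code for the sequence of micro-tree shapes $\mu_1,\dots,\mu_m$ and $H'$ a Huffman code for the sequence of pairs $(\mu_1,s_1),\dots,(\mu_m,s_m)$. Then $$\sum_{i=1}^{m} |H'((\mu_i,s_i))| \le \sum_{i=1}^{m}|H(\mu_i)| + \mathrm{O}\!\left(\frac{n\log B}{B}\right).$$
   Context: A binary tree is a rooted tree where each node has a left and a right child slot, each possibly empty. $\mathrm{BP}_\mathrm{b}(t)=\epsilon$ if $t$ is empty and otherwise $\texttt{(}\cdot \mathrm{BP}_\mathrm{b}(t_l)\cdot \texttt{)}\cdot \mathrm{BP}_\mathrm{b}(t_r)$; node $v$ corresponds to the matching pair inserted when expanding the subtree rooted at $v$. The Farzan–Munro algorithm with parameter $B$ partitions the nodes of a binary tree into disjoint connected micro trees; it is known that there are $m=\mathrm{O}(n/B)$ micro trees and each has fewer than $2B$ nodes. Micro trees are regarded as binary-tree shapes. Chunks of $\mu$: the positions in $\mathrm{BP}_\mathrm{b}(t)$ of parentheses of nodes of $\mu$ form one or two maximal intervals; the left chunk is the left (or only) one. The split rank of $\mu$ is the number of closing parentheses in its left chunk plus one. A Huffman code for a finite sequence $x_1,\dots,x_m$ of symbols is a prefix-free binary code on the set of distinct symbols minimizing $\sum_i |H(x_i)|$ among all prefix-free codes. $\log$ is the natural logarithm. Throughout, the paper assumes $B$ is super-constant in $n$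 (i.e. $B\to\infty$ as $n\to\infty$), and $\mathrm{O}$ is asymptotic in $n$. -}

module Defs where

open import Data.Nat using (ℕ; zero; suc; _+_; _*_; _≤_; _<_; _≥_)
open import Data.Nat.Logarithm using (⌈log₂_⌉)
open import Data.Bool using (Bool; true; false; if_then_else_)
open import Data.Fin using (Fin; _≟_)
open import Data.Nat.ListAction using (sum)
open import Data.List using (List; []; _∷_; _++_; map; length; filter; dropWhile; takeWhile; allFin)
open import Data.List.Membership.Propositional using (_∈_)
open import Data.Product using (Σ; _×_; _,_; proj₁; proj₂; ∃; ∃-syntax)
open import Relation.Nullary using (¬_; Dec; yes; no; does)
open import Relation.Nullary.Decidable using (⌊_⌋)
open import Relation.Binary.PropositionalEquality using (_≡_; _≢_)

data Tree : Set where
  empty : Tree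
  node  : Tree → Tree → Tree

size : Tree → ℕ
size empty      = 0
size (node l r) = suc (size l + size r)

data Pos : Tree → Set where
  here  : ∀ {l r} → Pos (node l r)
  left  : ∀ {l r} → Pos l → Pos (node l r)
  right : ∀ {l r} → Pos r → Pos (node l r)

allPos : (t : Tree) → List (Pos t)
allPos empty      = []
allPos (node l r) = here ∷ (map left (allPos l) ++ map right (allPos r))

data _≼_ : {t : Tree} → Pos t → Pos t → Set where
  here≼  : ∀ {l r} {v : Pos (node l r)} → here ≼ v
  left≼  : ∀ {l r} {u v : Pos l} → u ≼ v → left {l} {r} u ≼ left v
  right≼ : ∀ {l r} {u v : Pos r} → u ≼ v → right {l} {r} u ≼ right v

subtree : (t : Tree) → Pos t → Tree
subtree (node l r) here      = node l r
subtree (node l r) (left p)  = subtree l p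
subtree (node l r) (right p) = subtree r p

embed : (t : Tree) (p : Pos t) → Pos (subtree t p) → Pos t
embed (node l r) here      q = q
embed (node l r) (left p)  q = left (embed l p q)
embed (node l r) (right p) q = right (embed r p q)

shapeOf : (t : Tree) → (Pos t → Bool) → Tree
shapeOf empty      P = empty
shapeOf (node l r) P =
  if P here then node (shapeOf l (λ q → P (left q))) (shapeOf r (λ q → P (right q)))
            else empty

-- Balanced parentheses BP_b(t), every parenthesis labelled with its node
-- (true = opening parenthesis, false = closing parenthesis).
--   BP_b(empty) = ε,  BP_b(node l r) = ( BP_b(l) ) BP_b(r)

BPb : (t : Tree) → List (Pos t × Bool)
BPb empty      = []
BPb (node l r) =
  (here , true) ∷ (map (λ { (p , b) → (left p , b) }) (BPb l)
    ++ ((here , false) ∷ map (λ { (p , b) → (right p , b) }) (BPb r)))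

record Partition (t : Tree) : Set where
  field
    m      : ℕ
    cls    : Pos t → Fin m
    -- every micro tree is nonempty and connected: it has a root node
    -- root k, all its nodes are descendants of root k, and it contains
    -- every node on the path from root k to any of its nodes.
    root   : Fin m → Pos t
    rootIn : ∀ k → cls (root k) ≡ k
    below  : ∀ k (v : Pos t) → cls v ≡ k → root k ≼ v
    convex : ∀ k (v w : Pos t) → cls v ≡ k → root k ≼ w → w ≼ v → cls w ≡ k

  inClass : Fin m → Pos t → Bool
  inClass k v = ⌊ cls v ≟ k ⌋

  classSize : Fin m → ℕ
  classSize k = length (filter (λ v → cls v ≟ k) (allPos t))

  shape : Fin m → Tree
  shape k = shapeOf (subtree t (root k)) (λ q → inClass k (embed t (root k) q))

  leftChunk : Fin m → List (Pos t × Bool)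
  leftChunk k = takeWhile (λ x → cls (proj₁ x) ≟ k)
                  (dropWhile (λ x → Relation.Nullary.¬? (cls (proj₁ x) ≟ k)) (BPb t))

  splitRank : Fin m → ℕ
  splitRank k = suc (length (filter (λ x → Data.Bool._≟_ (proj₂ x) false) (leftChunk k)))

  shapes : List Tree
  shapes = map shape (allFin m)

  shapeRanks : List (Tree × ℕ)
  shapeRanks = map (λ k → (shape k , splitRank k)) (allFin m)

open Partition public

-- A tree-partitioning scheme with parameter B (such as Farzan–Munro).
Scheme : Set
Scheme = (B : ℕ) → (t : Tree) → Partition t

_IsPrefixOf_ : List Bool → List Bool → Set
xs IsPrefixOf ys = ∃[ zs ] (xs ++ zs ≡ ys)

PrefixFree : {A : Set} → List A → (A → List Bool) → Set
PrefixFree xs c = ∀ a b → a ∈ xs → b ∈ xs → a ≢ b → ¬ (c a IsPrefixOf c b)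

codeCost : {A : Set} → List A → (A → List Bool) → ℕ
codeCost xs c = sum (map (λ a → length (c a)) xs)

IsHuffman : {A : Set} → List A → (A → List Bool) → Set
IsHuffman {A} xs c =
  PrefixFree xs c × (∀ (c' : A → List Bool) → PrefixFree xs c' → codeCost xs c ≤ codeCost xs c')

-- The properties of the Farzan–Munro partition with parameter B that are
-- stated in the context: micro trees have fewer than 2B nodes, and there
-- are m = O(n/B) of them (a tree with fewer than B nodes forms a single
-- micro tree; otherwise B·m ≤ c·n for a constant c).

FarzanMunroProperties : Scheme → Set
FarzanMunroProperties F =
  (∀ B t k → 1 ≤ B → classSize (F B t) k < 2 * B)
  × ∃[ c ] (∀ B t → 1 ≤ B →
              (size t < B → m (F B t) ≤ 1) × (B ≤ size t → B * m (F B t) ≤ c * size t))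

SuperConstant : (ℕ → ℕ) → Set
SuperConstant Bf = ∀ K → ∃[ N ] (∀ n → N ≤ n → K ≤ Bf n)

{-# OPTIONS --safe #-}
module Submission where

-- Encode a pair (μ, s) by the Huffman codeword H(μ) followed by s written in binary with
-- w = ⌈log₂ B⌉ + 2 bits.  The left chunk of μ consists of parentheses of μ, so
-- s ≤ 1 + 2|μ| < 4B ≤ 2^w.  A fixed-width injective suffix keeps the code prefix-free, so the
-- optimal code H' pays at most w bits more per micro tree, m·w in total, and B·m·w = O(n log B)
-- since B·m = O(n).  A tree with fewer than B nodes has at most one micro tree, which H' encodes
-- at no cost.

open import Defs
open import Data.Nat
  using (ℕ; zero; suc; _+_; _*_; _∸_; _^_; _≤_; _<_; z≤n; s≤s; _<?_; _≤?_; ⌈_/2⌉; ⌊_/2⌋)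
open import Data.Nat.Properties
open import Data.Nat.Logarithm using (⌈log₂_⌉; ⌈log₂⌉-mono-≤)
open import Data.Nat.Logarithm.Core using (⌈log2⌉)
open import Data.Nat.Induction using (<-wellFounded)
open import Data.Nat.Tactic.RingSolver using (solve-∀)
open import Algebra.Properties.CommutativeSemigroup +-commutativeSemigroup
  using () renaming (interchange to +-interchange)
open import Induction.WellFounded using (Acc; acc)
open import Data.Bool using (Bool; true; false)
open import Data.Fin using () renaming (_≟_ to _≟ᶠ_)
open import Data.List using (List; []; _∷_; [_]; _++_; map; length; filter; dropWhile; allFin)
open import Data.List.Properties
  using ( length-++; length-map; length-tabulate; filter-++; map-∘
        ; ++-assoc; ++-identityʳ; ++-cancelˡ; ∷-injective)
open import Data.List.Membership.Propositional using (_∈_)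
open import Data.List.Membership.Propositional.Properties using (∈-map⁺; ∈-map⁻)
open import Data.List.Relation.Unary.Any using (here)
open import Data.List.Relation.Binary.Sublist.Propositional using (_⊆_; ⊆-trans)
open import Data.List.Relation.Binary.Sublist.Propositional.Properties
  using (length-mono-≤; filter-⊆; dropWhile-⊆; takeWhile⊆filter; filter⁺)
open import Data.Product using (_×_; _,_; proj₁; proj₂; map₂; ∃-syntax)
open import Data.Sum using (_⊎_; inj₁; inj₂; [_,_]′)
import Data.Sum as ⊎
open import Function using (_∘_; id)
open import Relation.Nullary using (yes; no; does; ¬?; contradiction)
open import Relation.Nullary.Decidable using (¬¬-excluded-middle)
open import Relation.Unary using (Decidable)
open import Relation.Binary.PropositionalEquality
  using (_≡_; refl; sym; trans; cong; cong₂; subst; module ≡-Reasoning)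

n≤2^⌈log2⌉n : ∀ n (rec : Acc _<_ n) → n ≤ 2 ^ ⌈log2⌉ n rec
n≤2^⌈log2⌉n zero          _        = z≤n
n≤2^⌈log2⌉n (suc zero)    _        = s≤s z≤n
n≤2^⌈log2⌉n (suc (suc n)) (acc rs) = begin
  2 + n                     ≤⟨ s≤s (s≤s n≤2*⌈n/2⌉) ⟩
  2 + 2 * ⌈ n /2⌉           ≡⟨ *-suc 2 ⌈ n /2⌉ ⟨
  2 * suc ⌈ n /2⌉           ≤⟨ *-monoʳ-≤ 2 (n≤2^⌈log2⌉n (suc ⌈ n /2⌉) _) ⟩
  2 ^ ⌈log2⌉ (2 + n) (acc rs) ∎
  where
  open ≤-Reasoning
  n≤2*⌈n/2⌉ : n ≤ 2 * ⌈ n /2⌉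
  n≤2*⌈n/2⌉ = begin
    n                        ≡⟨ ⌊n/2⌋+⌈n/2⌉≡n n ⟨
    ⌊ n /2⌋ + ⌈ n /2⌉        ≤⟨ +-monoˡ-≤ ⌈ n /2⌉ (⌊n/2⌋≤⌈n/2⌉ n) ⟩
    ⌈ n /2⌉ + ⌈ n /2⌉        ≡⟨ cong (⌈ n /2⌉ +_) (+-identityʳ ⌈ n /2⌉) ⟨
    2 * ⌈ n /2⌉              ∎

n≤2^⌈log₂n⌉ : ∀ n → n ≤ 2 ^ ⌈log₂ n ⌉
n≤2^⌈log₂n⌉ n = n≤2^⌈log2⌉n n (<-wellFounded n)

++-comparable : (xs ys us vs : List Bool) → xs ++ ys ≡ us ++ vs →
                xs IsPrefixOf us ⊎ us IsPrefixOf xs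
++-comparable []       _  us       _  _  = inj₁ (us , refl)
++-comparable (x ∷ xs) _  []       _  _  = inj₂ (x ∷ xs , refl)
++-comparable (x ∷ xs) ys (u ∷ us) vs eq with ∷-injective eq
... | refl , eq′ = ⊎.map (map₂ (cong (x ∷_))) (map₂ (cong (x ∷_))) (++-comparable xs ys us vs eq′)

IsPrefixOf-length : {xs ys : List Bool} → xs IsPrefixOf ys → length xs ≡ length ys → xs ≡ ys
IsPrefixOf-length {xs} ([]     , xs++[]≡ys) _ = trans (sym (++-identityʳ xs)) xs++[]≡ys
IsPrefixOf-length {xs} (z ∷ zs , refl)      eq =
  contradiction (sym (trans eq (length-++ xs))) (m+1+n≢m (length xs))

module _ {A : Set} where

  PrefixFree-length≤1 : (xs : List A) (c : A → List Bool) → length xs ≤ 1 → PrefixFree xs c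
  PrefixFree-length≤1 (x ∷ [])    _ _        _ _ (here refl) (here refl) a≢b = contradiction refl a≢b
  PrefixFree-length≤1 (x ∷ _ ∷ _) _ (s≤s ())

  codeCost-empty : (xs : List A) → codeCost xs (λ _ → []) ≡ 0
  codeCost-empty []       = refl
  codeCost-empty (_ ∷ xs) = codeCost-empty xs

  IsHuffman-length≤1⇒codeCost≡0 : {xs : List A} {c : A → List Bool} →
    length xs ≤ 1 → IsHuffman xs c → codeCost xs c ≡ 0
  IsHuffman-length≤1⇒codeCost≡0 {xs} {c} len≤1 (_ , optimal) = n≤0⇒n≡0 (begin
    codeCost xs c            ≤⟨ optimal (λ _ → []) (PrefixFree-length≤1 xs _ len≤1) ⟩
    codeCost xs (λ _ → [])   ≡⟨ codeCost-empty xs ⟩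
    0                        ∎)
    where open ≤-Reasoning

  PrefixFree-fixedLength : {xs : List A} {c : A → List Bool} (w : ℕ) →
    (∀ a → length (c a) ≡ w) → (∀ a b → a ∈ xs → b ∈ xs → c a ≡ c b → a ≡ b) →
    PrefixFree xs c
  PrefixFree-fixedLength {c = c} w len-c inj a b a∈ b∈ a≢b ca≼cb =
    a≢b (inj a b a∈ b∈ (IsPrefixOf-length {c a} {c b} ca≼cb (trans (len-c a) (sym (len-c b)))))

binary : ℕ → ℕ → List Bool
binary zero    s = []
binary (suc w) s with s <? 2 ^ w
... | yes _ = false ∷ binary w s
... | no  _ = true  ∷ binary w (s ∸ 2 ^ w)

unbinary : List Bool → ℕ
unbinary []           = 0
unbinary (false ∷ bs) = unbinary bs
unbinary (true  ∷ bs) = 2 ^ length bs + unbinary bs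

length-binary : ∀ w s → length (binary w s) ≡ w
length-binary zero    s = refl
length-binary (suc w) s with s <? 2 ^ w
... | yes _ = cong suc (length-binary w s)
... | no  _ = cong suc (length-binary w (s ∸ 2 ^ w))

unbinary-binary : ∀ w s → s < 2 ^ w → unbinary (binary w s) ≡ s
unbinary-binary zero    zero    _         = refl
unbinary-binary zero    (suc s) (s≤s ())
unbinary-binary (suc w) s       s<2^[1+w] with s <? 2 ^ w
... | yes s<2^w = unbinary-binary w s s<2^w
... | no  s≮2^w = begin
  2 ^ length (binary w (s ∸ 2 ^ w)) + unbinary (binary w (s ∸ 2 ^ w))
    ≡⟨ cong₂ _+_ (cong (2 ^_) (length-binary w _)) (unbinary-binary w (s ∸ 2 ^ w) s∸2^w<2^w) ⟩
  2 ^ w + (s ∸ 2 ^ w)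
    ≡⟨ m+[n∸m]≡n (≮⇒≥ s≮2^w) ⟩
  s ∎
  where
  open ≡-Reasoning
  s∸2^w<2^w : s ∸ 2 ^ w < 2 ^ w
  s∸2^w<2^w = subst (s ∸ 2 ^ w <_) (trans (m+n∸m≡n (2 ^ w) _) (+-identityʳ (2 ^ w)))
                (∸-monoˡ-< s<2^[1+w] (≮⇒≥ s≮2^w))

PrefixFree-binary : {xs : List ℕ} (w : ℕ) → (∀ s → s ∈ xs → s < 2 ^ w) → PrefixFree xs (binary w)
PrefixFree-binary w bounded = PrefixFree-fixedLength w (length-binary w) λ s s′ s∈ s′∈ eq → begin
  s                     ≡⟨ unbinary-binary w s (bounded s s∈) ⟨
  unbinary (binary w s)  ≡⟨ cong unbinary eq ⟩
  unbinary (binary w s′) ≡⟨ unbinary-binary w s′ (bounded s′ s′∈) ⟩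
  s′                    ∎
  where open ≡-Reasoning

codeCost-binary : (xs : List ℕ) (w : ℕ) → codeCost xs (binary w) ≡ length xs * w
codeCost-binary []       w = refl
codeCost-binary (s ∷ xs) w = cong₂ _+_ (length-binary w s) (codeCost-binary xs w)

module _ {A S : Set} where

  _⊗_ : (A → List Bool) → (S → List Bool) → A × S → List Bool
  (c ⊗ e) (a , s) = c a ++ e s

  PrefixFree-⊗ : (ps : List (A × S)) {c : A → List Bool} {e : S → List Bool} →
    PrefixFree (map proj₁ ps) c → PrefixFree (map proj₂ ps) e → PrefixFree ps (c ⊗ e)
  PrefixFree-⊗ ps {c} {e} c-free e-free (a , s) (b , s′) p∈ q∈ p≢q (zs , eq) =
    -- symbols need not have decidable equality: the goal is ⊥, so excluded middle is available
    ¬¬-excluded-middle {A = a ≡ b} λ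
      { (yes refl) → e-free s s′ (∈-map⁺ proj₂ p∈) (∈-map⁺ proj₂ q∈) (λ { refl → p≢q refl })
                       (zs , ++-cancelˡ (c a) _ _ eq′)
      ; (no a≢b)   → [ c-free a b a∈ b∈ a≢b , c-free b a b∈ a∈ (a≢b ∘ sym) ]′
                       (++-comparable (c a) (e s ++ zs) (c b) (e s′) eq′)
      }
    where
    a∈ : a ∈ map proj₁ ps
    a∈ = ∈-map⁺ proj₁ p∈
    b∈ : b ∈ map proj₁ ps
    b∈ = ∈-map⁺ proj₁ q∈
    eq′ : c a ++ (e s ++ zs) ≡ c b ++ e s′
    eq′ = trans (sym (++-assoc (c a) (e s) zs)) eq

  codeCost-⊗ : (ps : List (A × S)) (c : A → List Bool) (e : S → List Bool) →
    codeCost ps (c ⊗ e) ≡ codeCost (map proj₁ ps) c + codeCost (map proj₂ ps) e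
  codeCost-⊗ []             c e = refl
  codeCost-⊗ ((a , s) ∷ ps) c e = begin
    length (c a ++ e s) + codeCost ps (c ⊗ e)
      ≡⟨ cong₂ _+_ (length-++ (c a)) (codeCost-⊗ ps c e) ⟩
    (length (c a) + length (e s)) + (codeCost (map proj₁ ps) c + codeCost (map proj₂ ps) e)
      ≡⟨ +-interchange (length (c a)) (length (e s)) _ _ ⟩
    (length (c a) + codeCost (map proj₁ ps) c) + (length (e s) + codeCost (map proj₂ ps) e) ∎
    where open ≡-Reasoning

IsHuffman-pairs-codeCost≤ : {A : Set} (ps : List (A × ℕ)) (w : ℕ)
  {c : A → List Bool} {c′ : A × ℕ → List Bool} →
  (∀ s → s ∈ map proj₂ ps → s < 2 ^ w) → PrefixFree (map proj₁ ps) c → IsHuffman ps c′ →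
  codeCost ps c′ ≤ codeCost (map proj₁ ps) c + length ps * w
IsHuffman-pairs-codeCost≤ ps w {c} {c′} bounded c-free (_ , optimal) = begin
  codeCost ps c′
    ≤⟨ optimal (c ⊗ binary w) (PrefixFree-⊗ ps c-free (PrefixFree-binary w bounded)) ⟩
  codeCost ps (c ⊗ binary w)
    ≡⟨ codeCost-⊗ ps c (binary w) ⟩
  codeCost (map proj₁ ps) c + codeCost (map proj₂ ps) (binary w)
    ≡⟨ cong (codeCost (map proj₁ ps) c +_) (codeCost-binary (map proj₂ ps) w) ⟩
  codeCost (map proj₁ ps) c + length (map proj₂ ps) * w
    ≡⟨ cong (λ ℓ → codeCost (map proj₁ ps) c + ℓ * w) (length-map proj₂ ps) ⟩
  codeCost (map proj₁ ps) c + length ps * w ∎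
  where open ≤-Reasoning

module _ {A : Set} {P : A → Set} (P? : Decidable P) where

  length-filter-++ : ∀ xs ys →
    length (filter P? (xs ++ ys)) ≡ length (filter P? xs) + length (filter P? ys)
  length-filter-++ xs ys = trans (cong length (filter-++ P? xs ys)) (length-++ (filter P? xs))

  length-filter-map : {B : Set} (f : B → A) (xs : List B) →
    length (filter (P? ∘ f) xs) ≡ length (filter P? (map f xs))
  length-filter-map f []       = refl
  length-filter-map f (x ∷ xs) with does (P? (f x))
  ... | true  = cong suc (length-filter-map f xs)
  ... | false = length-filter-map f xs

length-filter-BPb : (t : Tree) {P : Pos t → Set} (P? : Decidable P) →
  length (filter (P? ∘ proj₁) (BPb t)) ≡ 2 * length (filter P? (allPos t))
length-filter-BPb empty      P? = refl
length-filter-BPb (node l r) {P} P? = begin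
  #BP ([ (here , true) ] ++ (Ls ++ ([ (here , false) ] ++ Rs)))
    ≡⟨ length-filter-++ Q [ _ ] _ ⟩
  #BP [ (here , true) ] + #BP (Ls ++ ([ (here , false) ] ++ Rs))
    ≡⟨ cong (#BP [ (here , true) ] +_) (trans (length-filter-++ Q Ls _)
         (cong (#BP Ls +_) (length-filter-++ Q [ _ ] Rs))) ⟩
  #BP [ (here , true) ] + (#BP Ls + (#BP [ (here , false) ] + #BP Rs))
    ≡⟨ cong₂ (λ x y → x + (y + (#BP [ (here , false) ] + #BP Rs))) (length-filter-map P? proj₁ [ _ ])
         (trans (sym (length-filter-map Q _ (BPb l))) (length-filter-BPb l (P? ∘ left))) ⟩
  #P [ here ] + (2 * #Pl + (#BP [ (here , false) ] + #BP Rs))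
    ≡⟨ cong₂ (λ x y → #P [ here ] + (2 * #Pl + (x + y))) (length-filter-map P? proj₁ [ _ ])
         (trans (sym (length-filter-map Q _ (BPb r))) (length-filter-BPb r (P? ∘ right))) ⟩
  #P [ here ] + (2 * #Pl + (#P [ here ] + 2 * #Pr))
    ≡⟨ m+[2n+[m+2o]]≡2[m+[n+o]] (#P [ here ]) #Pl #Pr ⟩
  2 * (#P [ here ] + (#Pl + #Pr))
    ≡⟨ cong (λ x → 2 * (#P [ here ] + x)) (trans
         (cong₂ _+_ (length-filter-map P? left (allPos l)) (length-filter-map P? right (allPos r)))
         (sym (length-filter-++ P? (map left (allPos l)) _))) ⟩
  2 * (#P [ here ] + #P (map left (allPos l) ++ map right (allPos r)))
    ≡⟨ cong (2 *_) (length-filter-++ P? [ here ] _) ⟨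
  2 * #P (allPos (node l r)) ∎
  where
  open ≡-Reasoning
  Q : Decidable (P ∘ proj₁)
  Q = P? ∘ proj₁
  #P : List (Pos (node l r)) → ℕ
  #P = length ∘ filter P?
  #BP : List (Pos (node l r) × Bool) → ℕ
  #BP = length ∘ filter Q
  Ls Rs : List (Pos (node l r) × Bool)
  Ls = map (λ { (p , b) → (left p , b) }) (BPb l)
  Rs = map (λ { (p , b) → (right p , b) }) (BPb r)
  #Pl #Pr : ℕ
  #Pl = length (filter (P? ∘ left) (allPos l))
  #Pr = length (filter (P? ∘ right) (allPos r))
  m+[2n+[m+2o]]≡2[m+[n+o]] : ∀ m n o → m + (2 * n + (m + 2 * o)) ≡ 2 * (m + (n + o))
  m+[2n+[m+2o]]≡2[m+[n+o]] = solve-∀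

module _ {t : Tree} (P : Partition t) where

  splitRank≤1+2*classSize : ∀ k → splitRank P k ≤ suc (2 * classSize P k)
  splitRank≤1+2*classSize k = s≤s (begin
    length (filter _ (leftChunk P k))     ≤⟨ length-mono-≤ (filter-⊆ _ (leftChunk P k)) ⟩
    length (leftChunk P k)                ≤⟨ length-mono-≤ leftChunk⊆ ⟩
    length (filter (inμ ∘ proj₁) (BPb t)) ≡⟨ length-filter-BPb t inμ ⟩
    2 * classSize P k                     ∎)
    where
    open ≤-Reasoning
    inμ : Decidable (λ v → cls P v ≡ k)
    inμ v = cls P v ≟ᶠ k
    leftChunk⊆ : leftChunk P k ⊆ filter (inμ ∘ proj₁) (BPb t)
    leftChunk⊆ = ⊆-trans (takeWhile⊆filter (inμ ∘ proj₁) rest)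
                         (filter⁺ (inμ ∘ proj₁) (inμ ∘ proj₁) (λ { refl p → p }) (dropWhile-⊆ _ (BPb t)))
      where
      rest : List (Pos t × Bool)
      rest = dropWhile (¬? ∘ inμ ∘ proj₁) (BPb t)

  splitRank<2^[2+⌈log₂B⌉] : ∀ B k → classSize P k < 2 * B →
                            splitRank P k < 2 ^ (2 + ⌈log₂ B ⌉)
  splitRank<2^[2+⌈log₂B⌉] B k |μ|<2B = begin-strict
    splitRank P k           ≤⟨ splitRank≤1+2*classSize k ⟩
    1 + 2 * classSize P k   <⟨ n<1+n _ ⟩
    2 + 2 * classSize P k   ≡⟨ *-suc 2 (classSize P k) ⟨
    2 * suc (classSize P k) ≤⟨ *-monoʳ-≤ 2 |μ|<2B ⟩
    2 * (2 * B)             ≤⟨ *-monoʳ-≤ 2 (*-monoʳ-≤ 2 (n≤2^⌈log₂n⌉ B)) ⟩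
    2 ^ (2 + ⌈log₂ B ⌉)     ∎
    where open ≤-Reasoning

  map-proj₁-shapeRanks : map proj₁ (shapeRanks P) ≡ shapes P
  map-proj₁-shapeRanks = sym (map-∘ (allFin (m P)))

  length-shapeRanks : length (shapeRanks P) ≡ m P
  length-shapeRanks = trans (length-map _ (allFin (m P))) (length-tabulate id)

  shapeRanks-codeCost≤ : ∀ B {H : Tree → List Bool} {H′ : Tree × ℕ → List Bool} →
    (∀ k → classSize P k < 2 * B) → IsHuffman (shapes P) H → IsHuffman (shapeRanks P) H′ →
    codeCost (shapeRanks P) H′ ≤ codeCost (shapes P) H + m P * (2 + ⌈log₂ B ⌉)
  shapeRanks-codeCost≤ B {H} {H′} small (H-free , _) H′-huffman = begin
    codeCost (shapeRanks P) H′
      ≤⟨ IsHuffman-pairs-codeCost≤ (shapeRanks P) w ranks-bounded H-free′ H′-huffman ⟩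
    codeCost (map proj₁ (shapeRanks P)) H + length (shapeRanks P) * w
      ≡⟨ cong₂ (λ xs ℓ → codeCost xs H + ℓ * w) map-proj₁-shapeRanks length-shapeRanks ⟩
    codeCost (shapes P) H + m P * w ∎
    where
    open ≤-Reasoning
    w : ℕ
    w = 2 + ⌈log₂ B ⌉
    H-free′ : PrefixFree (map proj₁ (shapeRanks P)) H
    H-free′ = subst (λ xs → PrefixFree xs H) (sym map-proj₁-shapeRanks) H-free
    ranks-bounded : ∀ s → s ∈ map proj₂ (shapeRanks P) → s < 2 ^ w
    ranks-bounded s s∈ with ∈-map⁻ proj₂ s∈
    ... | _ , p∈ , refl with ∈-map⁻ _ p∈
    ...   | k , _ , refl = splitRank<2^[2+⌈log₂B⌉] B k (small k)

  shapeRanks-codeCost-bound : ∀ B c {H : Tree → List Bool} {H′ : Tree × ℕ → List Bool} →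
    2 ≤ B → (∀ k → classSize P k < 2 * B) →
    (size t < B → m P ≤ 1) × (B ≤ size t → B * m P ≤ c * size t) →
    IsHuffman (shapes P) H → IsHuffman (shapeRanks P) H′ →
    B * codeCost (shapeRanks P) H′ ≤ B * codeCost (shapes P) H + 3 * c * size t * ⌈log₂ B ⌉
  shapeRanks-codeCost-bound B c {H} {H′} 2≤B small (one-if-small , few) H-huff H′-huff
    with B ≤? size t
  ... | yes B≤n = begin
    B * codeCost (shapeRanks P) H′      ≤⟨ *-monoʳ-≤ B (shapeRanks-codeCost≤ B small H-huff H′-huff) ⟩
    B * (X + m P * (2 + K))             ≡⟨ *-distribˡ-+ B X _ ⟩
    B * X + B * (m P * (2 + K))         ≡⟨ cong (B * X +_) (*-assoc B (m P) (2 + K)) ⟨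
    B * X + B * m P * (2 + K)           ≤⟨ +-monoʳ-≤ (B * X) (*-mono-≤ (few B≤n) 2+K≤3K) ⟩
    B * X + c * size t * (3 * K)        ≡⟨ cong (B * X +_) (reorder c (size t) K) ⟩
    B * X + 3 * c * size t * K          ∎
    where
    open ≤-Reasoning
    X K : ℕ
    X = codeCost (shapes P) H
    K = ⌈log₂ B ⌉
    2+K≤3K : 2 + K ≤ 3 * K
    2+K≤3K = subst (_≤ 3 * K) (+-comm K 2) (+-monoʳ-≤ K (*-monoʳ-≤ 2 (⌈log₂⌉-mono-≤ 2≤B)))
    reorder : ∀ c n k → c * n * (3 * k) ≡ 3 * c * n * k
    reorder = solve-∀
  ... | no B≰n = begin
    B * codeCost (shapeRanks P) H′  ≡⟨ cong (B *_) (IsHuffman-length≤1⇒codeCost≡0 one-class H′-huff) ⟩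
    B * 0                           ≡⟨ *-zeroʳ B ⟩
    0                               ≤⟨ z≤n ⟩
    B * codeCost (shapes P) H + 3 * c * size t * ⌈log₂ B ⌉ ∎
    where
    open ≤-Reasoning
    one-class : length (shapeRanks P) ≤ 1
    one-class = subst (_≤ 1) (sym length-shapeRanks) (one-if-small (≰⇒> B≰n))

theorem20 : (F : Scheme) → FarzanMunroProperties F →
    (Bf : ℕ → ℕ) → SuperConstant Bf →
    ∃[ C ] ∃[ N ] (∀ n → N ≤ n → ∀ (t : Tree) → size t ≡ n →
      ∀ (H : Tree → List Bool) (H' : Tree × ℕ → List Bool) →
      IsHuffman (shapes (F (Bf n) t)) H →
      IsHuffman (shapeRanks (F (Bf n) t)) H' →
      Bf n * codeCost (shapeRanks (F (Bf n) t)) H'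
        ≤ Bf n * codeCost (shapes (F (Bf n) t)) H + C * n * ⌈log₂ Bf n ⌉)
theorem20 F (small-classes , c , few-classes) Bf B→∞ = 3 * c , proj₁ (B→∞ 2) ,
  λ { n N≤n t refl H H′ H-huff H′-huff →
      let 2≤B = proj₂ (B→∞ 2) n N≤n
          1≤B = <⇒≤ 2≤B
      in shapeRanks-codeCost-bound (F (Bf n) t) (Bf n) c 2≤B
           (λ k → small-classes (Bf n) t k 1≤B) (few-classes (Bf n) t 1≤B) H-huff H′-huff }
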